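{- Let $\mathcal R$ be a weak bisimulation and let $M\,\mathcal R\,m$ (with $M$ a decentralized and $m$ a centralized monitor). Then, for all hypertraces $T,T'$ and verdicts $v$: (1) if $M\triangleright T\rightarrowtail M'\triangleright T'$ for some $M'$, then there exists $m'$ with $m\triangleright T\rightarrowtail^* m'\triangleright T'$ and $M'\,\mathcal R\,m'$; (2) if $m\triangleright T\rightarrowtail m'\triangleright T'$ for some $m'$, then there exists $M'$ with $M\triangleright T\rightarrowtail^* M'\triangleright T'$ and $M'\,\mathcal R\,m'$; (3) if $M\triangleright T\rightarrowtail v$, then $m\triangleright T\rightarrowtail v$; (4) if $m\triangleright T\rightarrowtail v$, then $M\triangleright T\rightarrowtail^* v$.
   Context: Model. Fix a finite set $\mathsf{Act}$ of actions with $|\mathsf{Act}|\ge 2$ and a finite non-empty set $\mathcal L$ of locations. $\mathsf{Trc}=\mathsf{Act}^\omega$; a hypertrace is $T:\mathcal L\to\mathsf{Trc}$, $\mathsf{HTrc}_{\mathcal L}$ is the set of hypertraces; for $A:\mathcal L\to\mathsf{Act}$, $T\xrightarrow{A}T'$ iff $T(\ell)=A(\ell)\,T'(\ell)$ for all $\ell$. Centralized monitors: $m::=\mathsf{yes}\mid\mathsf{no}\mid\mathsf{end}\mid a_\ell.m\mid m+m\mid m\oplus m\mid m\otimes m\mid\mathsf{rec}\,x.m\mid x$; verdicts $v\in\{\mathsf{yes},\mathsf{no},\mathsf{end}\}$; $\odot\in\{\otimes,\oplus\}$. Transitions $m\xrightarrow{A}m'$ (least relation): $v\xrightarrow{A}v$;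 $a_\ell.m\xrightarrow{A}m$ if $A(\ell)=a$; $a_\ell.m\xrightarrow{A}\mathsf{end}$ if $A(\ell)\neq a$; $\mathsf{rec}\,x.m\xrightarrow{A}m'$ if $m\{\mathsf{rec}\,x.m/x\}\xrightarrow{A}m'$; $m+n\xrightarrow{A}m'$ if $m\xrightarrow{A}m'$, $m+n\xrightarrow{A}n'$ if $n\xrightarrow{A}n'$; $m\odot n\xrightarrow{A}m'\odot n'$ if $m\xrightarrow{A}m'$ and $n\xrightarrow{A}n'$. Verdict evaluation $m\Rrightarrow v$: least relation closed under (each also with operands of $+,\otimes,\oplus$ swapped) $v\Rrightarrow v$; $m\odot n\Rrightarrow\mathsf{end}$ if both $\Rrightarrow\mathsf{end}$; $m\oplus n\Rrightarrow\mathsf{yes}$ if $m\Rrightarrow\mathsf{yes}$; $m\otimes n\Rrightarrow\mathsf{no}$ if $m\Rrightarrow\mathsf{no}$; $m+n\Rrightarrow v$ if $m\Rrightarrow v$; $m\oplus n\Rrightarrow v$ if $m\Rrightarrow\mathsf{no}$ and $n\Rrightarrow v$; $m\otimes n\Rrightarrow v$ if $m\Rrightarrow\mathsf{yes}$ and $n\Rrightarrow v$; $\mathsf{rec}\,x.m\Rrightarrow v$ if $m\{\mathsf{rec}\,x.m/x\}\Rrightarrow v$. Centralized instrumentation: $m\triangleright T\rightarrowtail m'\triangleright T'$ if $m\xrightarrow{A}m'$, $T\xrightarrow{A}T'$; $m\triangleright T\rightarrowtail v$ if $m\Rrightarrow v$. Decentralized monitors. Let $\mathsf{Con}\supseteq\mathsf{Act}$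 be a finite set of communication constants; communication actions are $(!G,\gamma)$ and $(?G,\gamma)$ with $G\subseteq\mathcal L$, $\gamma\in\mathsf{Con}$. Decentralized monitors $M::=[m]_\ell\mid M\vee M\mid M\wedge M$; local monitors $m::=\mathsf{yes}\mid\mathsf{no}\mid\mathsf{end}\mid a.m\mid c.m\mid m+m\mid m\oplus m\mid m\otimes m\mid\mathsf{rec}\,x.m\mid x$ ($a\in\mathsf{Act}$, $c$ a communication action). Local transitions, labels $\lambda\in\mathsf{Act}\cup\{(!G,\gamma)\}\cup\{(?\ell,\gamma)\mid\ell\in\mathcal L\}$ (rules also with operands of $+,\otimes,\oplus$ swapped): $a.m\xrightarrow{a}m$; $(?G,\gamma).m\xrightarrow{(?\ell,\gamma)}m$ if $\ell\in G$; $(!G,\gamma).m\xrightarrow{(!G,\gamma)}m$; $v\xrightarrow{a}v$; $\mathsf{rec}\,x.m\xrightarrow{\lambda}m'$ if $m\{\mathsf{rec}\,x.m/x\}\xrightarrow{\lambda}m'$; $m\odot n\xrightarrow{a}m'\odot n'$ if $m\xrightarrow{a}m'$ and $n\xrightarrow{a}n'$; $m\odot n\xrightarrow{(?\ell,\gamma)}m'\odot n'$ if both make that transition; $m+n\xrightarrow{\lambda}m'$ if $m\xrightarrow{\lambda}m'$; $m\odot n\xrightarrow{(!G,\gamma)}m'\odot n$ if $m\xrightarrow{(!G,\gamma)}m'$; $m\odot n\xrightarrow{(?\ell,\gamma)}m'\odot n$ if $m\xrightarrow{(?\ell,\gamma)}m'$ and $n$ has no $(?\ell,\gamma)$-transition.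 Decentralized rules ($\diamond\in\{\wedge,\vee\}$, also with operands swapped): $[m]_\ell\xrightarrow{\ell:(!G,\gamma)}[m']_\ell$ if $m\xrightarrow{(!G,\gamma)}m'$; reception judgement $[m]_\ell\overset{G:(?\ell',\gamma)}{\rightsquigarrow}[m']_\ell$ if $m\xrightarrow{(?\ell',\gamma)}m'$ and $\ell\in G$; $[m]_\ell\overset{G:(?\ell',\gamma)}{\rightsquigarrow}[m]_\ell$ if $m$ has no $(?\ell',\gamma)$-transition or if $\ell\notin G$; $M\diamond N\overset{G:(?\ell,\gamma)}{\rightsquigarrow}M'\diamond N'$ if both components do; $M\diamond N\xrightarrow{\ell:(!G,\gamma)}M'\diamond N'$ if $M\xrightarrow{\ell:(!G,\gamma)}M'$ and $N\overset{G:(?\ell,\gamma)}{\rightsquigarrow}N'$. Action steps: $[m]_\ell\xrightarrow{A}[m']_\ell$ if $A(\ell)=a$ and $m\xrightarrow{a}m'$; $[m]_\ell\xrightarrow{A}[\mathsf{end}]_\ell$ if $A(\ell)=a$, $m$ has no $a$-transition and no transition labelled by a communication action; $M\diamond N\xrightarrow{A}M'\diamond N'$ if $M\xrightarrow{A}M'$ and $N\xrightarrow{A}N'$. Verdicts: $[m]_\ell\Rrightarrow v$ if $m\Rrightarrow v$ (verdict rules above applied to local monitors); $M\diamond N\Rrightarrow\mathsf{end}$ if both $\Rrightarrow\mathsf{end}$; $M\wedge N\Rrightarrow\mathsf{no}$ if $M\Rrightarrow\mathsf{no}$; $M\wedge N\Rrightarrow v$ if $M\Rrightarrow\mathsf{yes}$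 and $N\Rrightarrow v$; $M\vee N\Rrightarrow\mathsf{yes}$ if $M\Rrightarrow\mathsf{yes}$; $M\vee N\Rrightarrow v$ if $M\Rrightarrow\mathsf{no}$ and $N\Rrightarrow v$ (also with operands swapped). Decentralized instrumentation: $M\triangleright T\rightarrowtail M'\triangleright T'$ if $M\xrightarrow{A}M'$ and $T\xrightarrow{A}T'$; $M\triangleright T\rightarrowtail M'\triangleright T$ if $M\xrightarrow{\ell:(!G,\gamma)}M'$; $M\triangleright T\rightarrowtail v$ if $M\Rrightarrow v$. $\rightarrowtail^*$ is the reflexive-transitive closure. Write $M\Rightarrow_c M'$ if $M'$ is reached from $M$ by a finite (possibly empty) sequence of transitions labelled $\ell_i:(!G_i,\gamma_i)$. Weak bisimulation: a relation $\mathcal R$ between decentralized and centralized monitors such that whenever $M\,\mathcal R\,m$: (1) for every verdict $v$, there exists $M'$ with $M\Rightarrow_c M'$ and $M'\Rrightarrow v$ if and only if $m\Rrightarrow v$; (2) if $M\xrightarrow{A}M'$ then there is $m'$ with $m\xrightarrow{A}m'$ and $M'\,\mathcal R\,m'$; (3) if $M\xrightarrow{\ell:(!G,\gamma)}M'$ then $M'\,\mathcal R\,m$; (4) if $m\xrightarrow{A}m'$ then there exist $M_1,M_2,M'$ with $M\Rightarrow_c M_1\xrightarrow{A}M_2\Rightarrow_c M'$ and $M'\,\mathcal R\,m'$. -}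

module Defs where

open import Data.Nat using (ℕ; zero; suc)
import Data.Nat as Nat
open import Data.Fin using (Fin)
open import Data.Fin.Subset using (Subset; _∈_; _∉_)
open import Data.Sum using (_⊎_)
open import Data.Product using (Σ; ∃; _×_; _,_)
open import Data.Bool using (if_then_else_)
open import Relation.Nullary using (¬_; does)
open import Relation.Binary.PropositionalEquality using (_≡_)
open import Relation.Binary.Construct.Closure.ReflexiveTransitive using (Star)

data Verdict : Set where
  yes no end : Verdict

data Op : Set where
  ⊗ ⊕ : Op

Var : Set
Var = ℕ

-- Act = Fin nA, 𝓛 = Fin nL, Con = Act ⊎ Fin nE (a finite superset of Act).
module Setup (nA nL nE : ℕ) where

  Act : Set
  Act = Fin nA

  Loc : Set
  Loc = Fin nL

  Con : Set
  Con = Act ⊎ Fin nE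

  Trc : Set
  Trc = ℕ → Act

  HTrc : Set
  HTrc = Loc → Trc

  Action : Set
  Action = Loc → Act

  -- T --A--> T'  iff  T(ℓ) = A(ℓ) T'(ℓ) for all ℓ
  _─[_]→ₜ_ : HTrc → Action → HTrc → Set
  T ─[ A ]→ₜ T' = ∀ ℓ → (T ℓ zero ≡ A ℓ) × (∀ n → T' ℓ n ≡ T ℓ (suc n))

  data CMon : Set where
    verd : Verdict → CMon
    pre  : Act → Loc → CMon → CMon
    _+_  : CMon → CMon → CMon
    par  : Op → CMon → CMon → CMon
    rec  : Var → CMon → CMon
    var  : Var → CMon

  csubst : CMon → Var → CMon → CMon
  csubst (verd v) x n = verd v
  csubst (pre a ℓ m) x n = pre a ℓ (csubst m x n)
  csubst (m₁ + m₂) x n = csubst m₁ x n + csubst m₂ x n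
  csubst (par o m₁ m₂) x n = par o (csubst m₁ x n) (csubst m₂ x n)
  csubst (rec y m) x n = if does (x Nat.≟ y) then rec y m else rec y (csubst m x n)
  csubst (var y) x n = if does (x Nat.≟ y) then n else var y

  data _─[_]→c_ : CMon → Action → CMon → Set where
    c-verd : ∀ {v A} → verd v ─[ A ]→c verd v
    c-pre  : ∀ {a ℓ m A} → A ℓ ≡ a → pre a ℓ m ─[ A ]→c m
    c-preE : ∀ {a ℓ m A} → ¬ (A ℓ ≡ a) → pre a ℓ m ─[ A ]→c verd end
    c-rec  : ∀ {x m m' A} → csubst m x (rec x m) ─[ A ]→c m' → rec x m ─[ A ]→c m'
    c-+l   : ∀ {m n m' A} → m ─[ A ]→c m' → (m + n) ─[ A ]→c m'
    c-+r   : ∀ {m n n' A} → n ─[ A ]→c n' → (m + n) ─[ A ]→c n'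
    c-par  : ∀ {o m n m' n' A} → m ─[ A ]→c m' → n ─[ A ]→c n' →
             par o m n ─[ A ]→c par o m' n'

  data _⇛c_ : CMon → Verdict → Set where
    ce-verd : ∀ {v} → verd v ⇛c v
    ce-end  : ∀ {o m n} → m ⇛c end → n ⇛c end → par o m n ⇛c end
    ce-⊕yl  : ∀ {m n} → m ⇛c yes → par ⊕ m n ⇛c yes
    ce-⊕yr  : ∀ {m n} → n ⇛c yes → par ⊕ m n ⇛c yes
    ce-⊗nl  : ∀ {m n} → m ⇛c no → par ⊗ m n ⇛c no
    ce-⊗nr  : ∀ {m n} → n ⇛c no → par ⊗ m n ⇛c no
    ce-+l   : ∀ {m n v} → m ⇛c v → (m + n) ⇛c v
    ce-+r   : ∀ {m n v} → n ⇛c v → (m + n) ⇛c v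
    ce-⊕l   : ∀ {m n v} → m ⇛c no → n ⇛c v → par ⊕ m n ⇛c v
    ce-⊕r   : ∀ {m n v} → n ⇛c no → m ⇛c v → par ⊕ m n ⇛c v
    ce-⊗l   : ∀ {m n v} → m ⇛c yes → n ⇛c v → par ⊗ m n ⇛c v
    ce-⊗r   : ∀ {m n v} → n ⇛c yes → m ⇛c v → par ⊗ m n ⇛c v
    ce-rec  : ∀ {x m v} → csubst m x (rec x m) ⇛c v → rec x m ⇛c v

  data CConf : Set where
    _▷c_ : CMon → HTrc → CConf
    cv   : Verdict → CConf

  data _↣c_ : CConf → CConf → Set where
    ci-step : ∀ {m m' T T' A} → m ─[ A ]→c m' → T ─[ A ]→ₜ T' → (m ▷c T) ↣c (m' ▷c T')
    ci-verd : ∀ {m T v} → m ⇛c v → (m ▷c T) ↣c cv v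

  _↣c*_ : CConf → CConf → Set
  _↣c*_ = Star _↣c_

  data LMon : Set where
    verd : Verdict → LMon
    act  : Act → LMon → LMon
    snd  : Subset nL → Con → LMon → LMon
    rcv  : Subset nL → Con → LMon → LMon
    _+_  : LMon → LMon → LMon
    par  : Op → LMon → LMon → LMon
    rec  : Var → LMon → LMon
    var  : Var → LMon

  lsubst : LMon → Var → LMon → LMon
  lsubst (verd v) x n = verd v
  lsubst (act a m) x n = act a (lsubst m x n)
  lsubst (snd G γ m) x n = snd G γ (lsubst m x n)
  lsubst (rcv G γ m) x n = rcv G γ (lsubst m x n)
  lsubst (m₁ + m₂) x n = lsubst m₁ x n + lsubst m₂ x n
  lsubst (par o m₁ m₂) x n = par o (lsubst m₁ x n) (lsubst m₂ x n)
  lsubst (rec y m) x n = if does (x Nat.≟ y) then rec y m else rec y (lsubst m x n)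
  lsubst (var y) x n = if does (x Nat.≟ y) then n else var y

  data Label : Set where
    lact : Act → Label
    lsnd : Subset nL → Con → Label
    lrcv : Loc → Con → Label

  -- Existence of a (?ℓ,γ)-transition, defined positively.
  data CanRcv : LMon → Loc → Con → Set where
    cr-rcv : ∀ {G γ m ℓ} → ℓ ∈ G → CanRcv (rcv G γ m) ℓ γ
    cr-rec : ∀ {x m ℓ γ} → CanRcv (lsubst m x (rec x m)) ℓ γ → CanRcv (rec x m) ℓ γ
    cr-+l  : ∀ {m n ℓ γ} → CanRcv m ℓ γ → CanRcv (m + n) ℓ γ
    cr-+r  : ∀ {m n ℓ γ} → CanRcv n ℓ γ → CanRcv (m + n) ℓ γ
    cr-parl : ∀ {o m n ℓ γ} → CanRcv m ℓ γ → CanRcv (par o m n) ℓ γ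
    cr-parr : ∀ {o m n ℓ γ} → CanRcv n ℓ γ → CanRcv (par o m n) ℓ γ

  data _─[_]→l_ : LMon → Label → LMon → Set where
    l-act   : ∀ {a m} → act a m ─[ lact a ]→l m
    l-rcv   : ∀ {G γ m ℓ} → ℓ ∈ G → rcv G γ m ─[ lrcv ℓ γ ]→l m
    l-snd   : ∀ {G γ m} → snd G γ m ─[ lsnd G γ ]→l m
    l-verd  : ∀ {v a} → verd v ─[ lact a ]→l verd v
    l-rec   : ∀ {x m m' λ'} → lsubst m x (rec x m) ─[ λ' ]→l m' → rec x m ─[ λ' ]→l m'
    l-paract : ∀ {o m n m' n' a} → m ─[ lact a ]→l m' → n ─[ lact a ]→l n' →
               par o m n ─[ lact a ]→l par o m' n'
    l-parrcv : ∀ {o m n m' n' ℓ γ} → m ─[ lrcv ℓ γ ]→l m' → n ─[ lrcv ℓ γ ]→l n' →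
               par o m n ─[ lrcv ℓ γ ]→l par o m' n'
    l-+l    : ∀ {m n m' λ'} → m ─[ λ' ]→l m' → (m + n) ─[ λ' ]→l m'
    l-+r    : ∀ {m n n' λ'} → n ─[ λ' ]→l n' → (m + n) ─[ λ' ]→l n'
    l-sndl  : ∀ {o m n m' G γ} → m ─[ lsnd G γ ]→l m' → par o m n ─[ lsnd G γ ]→l par o m' n
    l-sndr  : ∀ {o m n n' G γ} → n ─[ lsnd G γ ]→l n' → par o m n ─[ lsnd G γ ]→l par o m n'
    l-rcvl  : ∀ {o m n m' ℓ γ} → m ─[ lrcv ℓ γ ]→l m' → ¬ CanRcv n ℓ γ →
              par o m n ─[ lrcv ℓ γ ]→l par o m' n
    l-rcvr  : ∀ {o m n n' ℓ γ} → n ─[ lrcv ℓ γ ]→l n' → ¬ CanRcv m ℓ γ →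
              par o m n ─[ lrcv ℓ γ ]→l par o m n'

  data _⇛l_ : LMon → Verdict → Set where
    le-verd : ∀ {v} → verd v ⇛l v
    le-end  : ∀ {o m n} → m ⇛l end → n ⇛l end → par o m n ⇛l end
    le-⊕yl  : ∀ {m n} → m ⇛l yes → par ⊕ m n ⇛l yes
    le-⊕yr  : ∀ {m n} → n ⇛l yes → par ⊕ m n ⇛l yes
    le-⊗nl  : ∀ {m n} → m ⇛l no → par ⊗ m n ⇛l no
    le-⊗nr  : ∀ {m n} → n ⇛l no → par ⊗ m n ⇛l no
    le-+l   : ∀ {m n v} → m ⇛l v → (m + n) ⇛l v
    le-+r   : ∀ {m n v} → n ⇛l v → (m + n) ⇛l v
    le-⊕l   : ∀ {m n v} → m ⇛l no → n ⇛l v → par ⊕ m n ⇛l v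
    le-⊕r   : ∀ {m n v} → n ⇛l no → m ⇛l v → par ⊕ m n ⇛l v
    le-⊗l   : ∀ {m n v} → m ⇛l yes → n ⇛l v → par ⊗ m n ⇛l v
    le-⊗r   : ∀ {m n v} → n ⇛l yes → m ⇛l v → par ⊗ m n ⇛l v
    le-rec  : ∀ {x m v} → lsubst m x (rec x m) ⇛l v → rec x m ⇛l v

  data DOp : Set where
    ∧ ∨ : DOp

  data DMon : Set where
    [_]_ : LMon → Loc → DMon
    dop  : DOp → DMon → DMon → DMon






  data _⇝[_∶?_,_]_ : DMon → Subset nL → Loc → Con → DMon → Set where
    r-yes  : ∀ {m m' ℓ G ℓ' γ} → m ─[ lrcv ℓ' γ ]→l m' → ℓ ∈ G →
             ([ m ] ℓ) ⇝[ G ∶? ℓ' , γ ] ([ m' ] ℓ)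
    r-none : ∀ {m ℓ G ℓ' γ} → ¬ (∃ λ m' → m ─[ lrcv ℓ' γ ]→l m') →
             ([ m ] ℓ) ⇝[ G ∶? ℓ' , γ ] ([ m ] ℓ)
    r-out  : ∀ {m ℓ G ℓ' γ} → ℓ ∉ G →
             ([ m ] ℓ) ⇝[ G ∶? ℓ' , γ ] ([ m ] ℓ)
    r-op   : ∀ {d M N M' N' G ℓ γ} → M ⇝[ G ∶? ℓ , γ ] M' → N ⇝[ G ∶? ℓ , γ ] N' →
             dop d M N ⇝[ G ∶? ℓ , γ ] dop d M' N'

  data _─[_∶!_,_]→_ : DMon → Loc → Subset nL → Con → DMon → Set where
    s-leaf : ∀ {m m' ℓ G γ} → m ─[ lsnd G γ ]→l m' → ([ m ] ℓ) ─[ ℓ ∶! G , γ ]→ ([ m' ] ℓ)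
    s-opl  : ∀ {d M N M' N' ℓ G γ} → M ─[ ℓ ∶! G , γ ]→ M' → N ⇝[ G ∶? ℓ , γ ] N' →
             dop d M N ─[ ℓ ∶! G , γ ]→ dop d M' N'
    s-opr  : ∀ {d M N M' N' ℓ G γ} → N ─[ ℓ ∶! G , γ ]→ N' → M ⇝[ G ∶? ℓ , γ ] M' →
             dop d M N ─[ ℓ ∶! G , γ ]→ dop d M' N'

  data _─[_]→d_ : DMon → Action → DMon → Set where
    d-leaf : ∀ {m m' ℓ A} → m ─[ lact (A ℓ) ]→l m' → ([ m ] ℓ) ─[ A ]→d ([ m' ] ℓ)
    d-end  : ∀ {m ℓ A} → ¬ (∃ λ m' → m ─[ lact (A ℓ) ]→l m') →
             ¬ (∃ λ G → ∃ λ γ → ∃ λ m' → m ─[ lsnd G γ ]→l m') →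
             ¬ (∃ λ ℓ' → ∃ λ γ → ∃ λ m' → m ─[ lrcv ℓ' γ ]→l m') →
             ([ m ] ℓ) ─[ A ]→d ([ verd end ] ℓ)
    d-op   : ∀ {d M N M' N' A} → M ─[ A ]→d M' → N ─[ A ]→d N' →
             dop d M N ─[ A ]→d dop d M' N'

  data _⇛d_ : DMon → Verdict → Set where
    de-leaf : ∀ {m ℓ v} → m ⇛l v → ([ m ] ℓ) ⇛d v
    de-end  : ∀ {d M N} → M ⇛d end → N ⇛d end → dop d M N ⇛d end
    de-∧nl  : ∀ {M N} → M ⇛d no → dop ∧ M N ⇛d no
    de-∧nr  : ∀ {M N} → N ⇛d no → dop ∧ M N ⇛d no
    de-∧l   : ∀ {M N v} → M ⇛d yes → N ⇛d v → dop ∧ M N ⇛d v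
    de-∧r   : ∀ {M N v} → N ⇛d yes → M ⇛d v → dop ∧ M N ⇛d v
    de-∨yl  : ∀ {M N} → M ⇛d yes → dop ∨ M N ⇛d yes
    de-∨yr  : ∀ {M N} → N ⇛d yes → dop ∨ M N ⇛d yes
    de-∨l   : ∀ {M N v} → M ⇛d no → N ⇛d v → dop ∨ M N ⇛d v
    de-∨r   : ∀ {M N v} → N ⇛d no → M ⇛d v → dop ∨ M N ⇛d v

  data DConf : Set where
    _▷d_ : DMon → HTrc → DConf
    dv   : Verdict → DConf

  data _↣d_ : DConf → DConf → Set where
    di-step : ∀ {M M' T T' A} → M ─[ A ]→d M' → T ─[ A ]→ₜ T' → (M ▷d T) ↣d (M' ▷d T')
    di-comm : ∀ {M M' T ℓ G γ} → M ─[ ℓ ∶! G , γ ]→ M' → (M ▷d T) ↣d (M' ▷d T)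
    di-verd : ∀ {M T v} → M ⇛d v → (M ▷d T) ↣d dv v

  _↣d*_ : DConf → DConf → Set
  _↣d*_ = Star _↣d_

  _⇒c_ : DMon → DMon → Set
  _⇒c_ = Star (λ M M' → ∃ λ ℓ → ∃ λ G → ∃ λ γ → M ─[ ℓ ∶! G , γ ]→ M')

  record WeakBisim (R : DMon → CMon → Set) : Set where
    field
      verdicts : ∀ {M m} → R M m → ∀ v →
                 ((∃ λ M' → (M ⇒c M') × (M' ⇛d v)) → m ⇛c v) ×
                 (m ⇛c v → ∃ λ M' → (M ⇒c M') × (M' ⇛d v))
      act-d    : ∀ {M m A M'} → R M m → M ─[ A ]→d M' →
                 ∃ λ m' → (m ─[ A ]→c m') × R M' m'
      comm-d   : ∀ {M m ℓ G γ M'} → R M m → M ─[ ℓ ∶! G , γ ]→ M' → R M' m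
      act-c    : ∀ {M m A m'} → R M m → m ─[ A ]→c m' →
                 ∃ λ M₁ → ∃ λ M₂ → ∃ λ M' →
                   (M ⇒c M₁) × (M₁ ─[ A ]→d M₂) × (M₂ ⇒c M') × R M' m'

-- Every instrumentation step is matched by one clause of weak bisimulation:
-- a decentralized action step by a single centralized step, a communication
-- step by the empty centralized run (the trace does not move), and a
-- centralized action step or verdict by a decentralized run in which the
-- communications demanded by the bisimulation are replayed on the unchanged
-- trace around the matching action step or verdict.
module Submission where

open import Defs
open import Data.Nat using (ℕ; _≤_)
open import Data.Product using (∃; _×_; _,_; proj₁; proj₂)
open import Relation.Binary.Construct.Closure.ReflexiveTransitive
  using (ε; _◅_; _◅◅_)

module _ {nA nL nE : ℕ} where
  open Setup nA nL nE

  ⇒c⇒↣d* : ∀ {M M'} T → M ⇒c M' → (M ▷d T) ↣d* (M' ▷d T)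
  ⇒c⇒↣d* T ε                      = ε
  ⇒c⇒↣d* T ((_ , _ , _ , s) ◅ ss) = di-comm s ◅ ⇒c⇒↣d* T ss

  module WeakBisimulation {R : DMon → CMon → Set} (W : WeakBisim R) where
    open WeakBisim W

    ↣d-simulated : ∀ {M m} → R M m → ∀ {T T' M'} → (M ▷d T) ↣d (M' ▷d T') →
                   ∃ λ m' → ((m ▷c T) ↣c* (m' ▷c T')) × R M' m'
    ↣d-simulated r (di-step s t) with act-d r s
    ... | m' , s' , r' = m' , ci-step s' t ◅ ε , r'
    ↣d-simulated {m = m} r (di-comm s) = m , ε , comm-d r s

    ↣c-simulated : ∀ {M m} → R M m → ∀ {T T' m'} → (m ▷c T) ↣c (m' ▷c T') →
                   ∃ λ M' → ((M ▷d T) ↣d* (M' ▷d T')) × R M' m'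
    ↣c-simulated r {T} {T'} (ci-step s t) with act-c r s
    ... | _ , _ , M' , before , s' , after , r' =
      M' , ⇒c⇒↣d* T before ◅◅ di-step s' t ◅ ⇒c⇒↣d* T' after , r'

    ↣d-verdict-sound : ∀ {M m} → R M m → ∀ {T v} →
                       (M ▷d T) ↣d dv v → (m ▷c T) ↣c cv v
    ↣d-verdict-sound {M} r {v = v} (di-verd e) =
      ci-verd (proj₁ (verdicts r v) (M , ε , e))

    ↣c-verdict-reachable : ∀ {M m} → R M m → ∀ {T v} →
                           (m ▷c T) ↣c cv v → (M ▷d T) ↣d* dv v
    ↣c-verdict-reachable r {T} {v} (ci-verd e) with proj₂ (verdicts r v) e
    ... | _ , comms , e' = ⇒c⇒↣d* T comms ◅◅ di-verd e' ◅ ε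

lemma4p3 : (nA nL nE : ℕ) → 2 ≤ nA → 1 ≤ nL →
    let open Setup nA nL nE in
    (R : DMon → CMon → Set) → WeakBisim R →
    ∀ {M m} → R M m → ∀ (T T' : HTrc) (v : Verdict) →
      (∀ M' → (M ▷d T) ↣d (M' ▷d T') → ∃ λ m' → ((m ▷c T) ↣c* (m' ▷c T')) × R M' m')
      × (∀ m' → (m ▷c T) ↣c (m' ▷c T') → ∃ λ M' → ((M ▷d T) ↣d* (M' ▷d T')) × R M' m')
      × ((M ▷d T) ↣d dv v → (m ▷c T) ↣c cv v)
      × ((m ▷c T) ↣c cv v → (M ▷d T) ↣d* dv v)
lemma4p3 _ _ _ _ _ R W r T T' v =
    (λ _ → ↣d-simulated r)
  , (λ _ → ↣c-simulated r)
  , ↣d-verdict-sound r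
  , ↣c-verdict-reachable r
  where open WeakBisimulation W
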